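{- Let $G$ be a connected bipartite fast graph. Then for every vertex $w$ of $G$, the graph $G\setminus N(w)$ (obtained by deleting the neighbours of $w$) contains no hole.
   Context: A hole is an induced (chordless) cycle of length at least five. The armchair is the graph obtained from a 4-cycle $abcd$ by attaching a pendant vertex (a new vertex of degree 1) to each of $a$, $b$ and $c$ (7 vertices). The stirrer is the graph obtained from the domino (two 4-cycles sharing an edge, i.e. the $2\times 3$ grid) by attaching one pendant vertex to one of its two degree-3 vertices. The tripod is the tree obtained from $K_{1,3}$ by subdividing each edge once (a central vertex with three disjoint paths of length 2). A graph is fast if it has no induced subgraph isomorphic to the armchair, the stirrer or the tripod. $N(w)$ is the open neighbourhood of $w$. -}

module Defs where

open import Data.Nat using (ℕ; zero; suc; _≤_)
open import Data.Fin using (Fin; toℕ; #_)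
open import Data.Product using (Σ; _×_; _,_; ∃-syntax)
open import Data.Sum using (_⊎_)
open import Data.Bool using (Bool)
open import Data.List using (List; []; _∷_)
open import Data.List.Relation.Unary.Any using (Any)
open import Relation.Nullary using (¬_; Dec)
open import Relation.Binary.PropositionalEquality using (_≡_; _≢_)
open import Function.Definitions using (Injective)
open import Function.Bundles using (_⇔_)

record Graph (n : ℕ) : Set₁ where
  field
    Adj     : Fin n → Fin n → Set
    sym     : ∀ {u v} → Adj u v → Adj v u
    irrefl  : ∀ {u} → ¬ Adj u u
    adj?    : ∀ u v → Dec (Adj u v)
open Graph public

data Walk {n : ℕ} (G : Graph n) : Fin n → Fin n → Set where
  here : ∀ {u} → Walk G u u
  step : ∀ {u v w} → Adj G u v → Walk G v w → Walk G u w

Connected : ∀ {n} → Graph n → Set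
Connected G = ∀ u v → Walk G u v

Bipartite : ∀ {n} → Graph n → Set
Bipartite {n} G = Σ (Fin n → Bool) λ c → ∀ u v → Adj G u v → c u ≢ c v

EdgeAdj : ∀ {k} → List (Fin k × Fin k) → Fin k → Fin k → Set
EdgeAdj E i j = Any (λ { (a , b) → (a ≡ i × b ≡ j) ⊎ (a ≡ j × b ≡ i) }) E

HasInduced : ∀ {n} → Graph n → (k : ℕ) → (Fin k → Fin k → Set) → Set
HasInduced {n} G k H =
  Σ (Fin k → Fin n) λ f → Injective _≡_ _≡_ f × (∀ i j → H i j ⇔ Adj G (f i) (f j))

-- Armchair: 4-cycle 0-1-2-3-0, pendants 4 at 0, 5 at 1, 6 at 2.
armchair : List (Fin 7 × Fin 7)
armchair = (# 0 , # 1) ∷ (# 1 , # 2) ∷ (# 2 , # 3) ∷ (# 3 , # 0)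
         ∷ (# 0 , # 4) ∷ (# 1 , # 5) ∷ (# 2 , # 6) ∷ []

-- Stirrer: domino = 2x3 grid with rows 0-1-2 and 3-4-5 (columns 0-3, 1-4, 2-5);
-- its degree-3 vertices are 1 and 4; pendant 6 attached to 1.
stirrer : List (Fin 7 × Fin 7)
stirrer = (# 0 , # 1) ∷ (# 1 , # 2) ∷ (# 3 , # 4) ∷ (# 4 , # 5)
        ∷ (# 0 , # 3) ∷ (# 1 , # 4) ∷ (# 2 , # 5) ∷ (# 1 , # 6) ∷ []

tripod : List (Fin 7 × Fin 7)
tripod = (# 0 , # 1) ∷ (# 1 , # 2) ∷ (# 0 , # 3) ∷ (# 3 , # 4)
       ∷ (# 0 , # 5) ∷ (# 5 , # 6) ∷ []

Fast : ∀ {n} → Graph n → Set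
Fast G = ¬ HasInduced G 7 (EdgeAdj armchair)
       × ¬ HasInduced G 7 (EdgeAdj stirrer)
       × ¬ HasInduced G 7 (EdgeAdj tripod)

CycAdj : (k : ℕ) → Fin k → Fin k → Set
CycAdj k i j = toℕ j ≡ suc (toℕ i) ⊎ toℕ i ≡ suc (toℕ j)
             ⊎ (toℕ i ≡ 0 × suc (toℕ j) ≡ k) ⊎ (toℕ j ≡ 0 × suc (toℕ i) ≡ k)

-- A hole in G \ N(w): an induced cycle of length k ≥ 5 in G none of whose
-- vertices is a neighbour of w (G \ N(w) is the induced subgraph on the
-- vertices not adjacent to w; note w itself remains).
HoleAvoidingN : ∀ {n} → Graph n → Fin n → Set
HoleAvoidingN {n} G w =
  ∃[ k ] (5 ≤ k × Σ (Fin k → Fin n) λ f →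
     Injective _≡_ _≡_ f
     × (∀ i → ¬ Adj G w (f i))
     × (∀ i j → CycAdj k i j ⇔ Adj G (f i) (f j)))

-- Let H be a hole of G avoiding N(w). A walk from w to H has an edge uv where u has no
-- neighbour on H but v does, say x. Let x₋₂ … x₂ be the hole vertices around x. If v is
-- adjacent to x₋₂ (or x₂), the 4-cycle v x₋₂ x₋₁ x with the pendants u, x₋₃ and x₁ (or its
-- mirror image) is an induced armchair; otherwise x with the paths x x₋₁ x₋₂, x x₁ x₂ and
-- x v u is an induced tripod. Bipartiteness rules out every adjacency between vertices at
-- even distance, the hole being induced every adjacency between hole vertices at distance 3.
module Submission where

open import Defs
open import Data.Nat using (ℕ; zero; suc; _+_; _∸_; _≤_; _<_; s≤s; z≤n; _<?_)
open import Data.Nat.Properties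
  using (<⇒≱; <⇒≤; ≮⇒≥; ≤-antisym; ≤-refl; <-trans; <-irrefl; n<1+n; m≤n+m; m≤m+n; m<n+m; +-comm; +-assoc;
         +-cancelˡ-≡; +-cancelʳ-≡; +-mono-≤-<; +-monoˡ-<; m+[n∸m]≡n; module ≤-Reasoning)
open import Data.Nat.GeneralisedArithmetic using (fold; fold-+)
open import Data.Fin using (Fin; toℕ; fromℕ<; zero; suc; _≟_)
open import Data.Fin.Properties as Fin using (toℕ-fromℕ<; toℕ-injective; toℕ<n)
open import Data.Bool using (Bool)
open import Data.Bool.Properties using (¬-not)
open import Data.Product using (_×_; _,_; ∃; ∃₂; proj₁; proj₂)
open import Data.Sum using (_⊎_; inj₁; inj₂; [_,_]; swap)
open import Data.Empty using (⊥-elim)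
open import Data.List using (List; []; _∷_; filter; cartesianProduct; allFin)
open import Data.List.Relation.Unary.Any as Any using (here; there; any?)
open import Data.List.Relation.Unary.All using (All; []; _∷_; lookup)
open import Data.List.Membership.Propositional.Properties using (∈-filter⁺; ∈-cartesianProduct⁺; ∈-allFin)
open import Data.Vec using ([]; _∷_) renaming (lookup to vlookup)
open import Relation.Binary using (tri<; tri≈; tri>)
open import Relation.Binary.PropositionalEquality using (_≡_; _≢_; refl; trans; cong; subst; module ≡-Reasoning) renaming (sym to ≡-sym)
open import Relation.Nullary using (¬_; Dec; yes; no)
open import Relation.Nullary.Decidable using (_×-dec_; _⊎-dec_; _→-dec_; ¬?; map′; toWitness; decidable-stable)
open import Relation.Unary using (Decidable)
open import Function.Bundles using (_⇔_; mk⇔; Equivalence)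
import Function.Properties.Equivalence as ⇔
open import Function using (_∘_)

-- For x, y < K and d ≤ K: y is d steps after x on the cycle ℤ/K.
CycShift : ℕ → ℕ → ℕ → ℕ → Set
CycShift K d x y = y ≡ d + x ⊎ y + K ≡ d + x

module _ {K : ℕ} where

  cycShift-step : ∀ {d x y z} → x < K → suc d ≤ K →
                  CycShift K d x y → CycShift K 1 y z → CycShift K (suc d) x z
  cycShift-step _ _ (inj₁ refl) (inj₁ refl) = inj₁ refl
  cycShift-step _ _ (inj₁ refl) (inj₂ e) = inj₂ e
  cycShift-step _ _ (inj₂ e) (inj₁ refl) = inj₂ (cong suc e)
  cycShift-step {d} {x} {y} {z} x<K 1+d≤K (inj₂ e₁) (inj₂ e₂) = ⊥-elim (<⇒≱ (+-mono-≤-< 1+d≤K x<K) K+K≤1+d+x)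
    where
    K+K≤1+d+x : K + K ≤ suc d + x
    K+K≤1+d+x = begin
      K + K       ≤⟨ m≤n+m (K + K) z ⟩
      z + (K + K) ≡⟨ ≡-sym (+-assoc z K K) ⟩
      z + K + K   ≡⟨ cong (_+ K) e₂ ⟩
      suc y + K   ≡⟨ cong suc e₁ ⟩
      suc d + x   ∎
      where open ≤-Reasoning

  cycShift-irrefl : ∀ {d x} → 0 < d → d < K → ¬ CycShift K d x x
  cycShift-irrefl {d} {x} 0<d _ (inj₁ e) = <-irrefl e (m<n+m x 0<d)
  cycShift-irrefl {d} {x} _ d<K (inj₂ e) = <-irrefl (≡-sym (+-cancelˡ-≡ x K d (trans e (+-comm d x)))) d<K

  private
    no-wrap : ∀ {d e x} → e < K → d + x + K ≢ e + x
    no-wrap {d} {e} {x} e<K eq = <⇒≱ (+-monoˡ-< x e<K) (begin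
      K + x       ≤⟨ m≤n+m (K + x) d ⟩
      d + (K + x) ≡⟨ cong (d +_) (+-comm K x) ⟩
      d + (x + K) ≡⟨ ≡-sym (+-assoc d x K) ⟩
      d + x + K   ≡⟨ eq ⟩
      e + x       ∎)
      where open ≤-Reasoning

  cycShift-unique : ∀ {d e x y} → d < K → e < K → CycShift K d x y → CycShift K e x y → d ≡ e
  cycShift-unique {d} {e} {x} _ _ (inj₁ refl) (inj₁ q) = +-cancelʳ-≡ x d e q
  cycShift-unique _ e<K (inj₁ refl) (inj₂ q) = ⊥-elim (no-wrap e<K q)
  cycShift-unique d<K e<K (inj₂ p) (inj₁ refl) = ≡-sym (cycShift-unique e<K d<K (inj₁ refl) (inj₂ p))
  cycShift-unique {d} {e} {x} _ _ (inj₂ p) (inj₂ q) = +-cancelʳ-≡ x d e (trans (≡-sym p) q)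

  cycShift-full : ∀ {x y} → y < K → CycShift K K x y → y ≡ x
  cycShift-full {x} {y} y<K (inj₁ e) = ⊥-elim (<⇒≱ y<K (subst (K ≤_) (≡-sym e) (m≤m+n K x)))
  cycShift-full {x} {y} _ (inj₂ e) = +-cancelʳ-≡ K y x (trans e (+-comm K x))

cycAdj⇒cycShift : ∀ {K} {i j : Fin K} → CycAdj K i j →
                  CycShift K 1 (toℕ i) (toℕ j) ⊎ CycShift K 1 (toℕ j) (toℕ i)
cycAdj⇒cycShift (inj₁ e) = inj₁ (inj₁ e)
cycAdj⇒cycShift (inj₂ (inj₁ e)) = inj₂ (inj₁ e)
cycAdj⇒cycShift {K} (inj₂ (inj₂ (inj₁ (i≡0 , e)))) = inj₂ (inj₂ (trans (cong (_+ K) i≡0) (≡-sym e)))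
cycAdj⇒cycShift {K} (inj₂ (inj₂ (inj₂ (j≡0 , e)))) = inj₁ (inj₂ (trans (cong (_+ K) j≡0) (≡-sym e)))

module _ {m : ℕ} where

  next : Fin (suc m) → Fin (suc m)
  next i with suc (toℕ i) <? suc m
  ... | yes i+1<K = fromℕ< i+1<K
  ... | no _      = zero

  private
    toℕ-last : ∀ (i : Fin (suc m)) → ¬ suc (toℕ i) < suc m → suc (toℕ i) ≡ suc m
    toℕ-last i i+1≮K = ≤-antisym (toℕ<n i) (≮⇒≥ i+1≮K)

  cycAdj-next : ∀ i → CycAdj (suc m) i (next i)
  cycAdj-next i with suc (toℕ i) <? suc m
  ... | yes i+1<K = inj₁ (toℕ-fromℕ< i+1<K)
  ... | no i+1≮K  = inj₂ (inj₂ (inj₂ (refl , toℕ-last i i+1≮K)))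

  cycShift-next : ∀ i → CycShift (suc m) 1 (toℕ i) (toℕ (next i))
  cycShift-next i with suc (toℕ i) <? suc m
  ... | yes i+1<K = inj₁ (toℕ-fromℕ< i+1<K)
  ... | no i+1≮K  = inj₂ (≡-sym (toℕ-last i i+1≮K))

  cycShift-fold : ∀ d → d ≤ suc m → ∀ j → CycShift (suc m) d (toℕ j) (toℕ (fold j next d))
  cycShift-fold zero _ j = inj₁ refl
  cycShift-fold (suc d) d<K j =
    cycShift-step (toℕ<n j) d<K (cycShift-fold d (<⇒≤ d<K) j) (cycShift-next (fold j next d))

  fold-next-period : ∀ j → fold j next (suc m) ≡ j
  fold-next-period j = toℕ-injective (cycShift-full (toℕ<n _) (cycShift-fold (suc m) ≤-refl j))

  fold-next-surjective : ∀ d → d ≤ suc m → ∀ i → ∃ λ j → fold j next d ≡ i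
  fold-next-surjective d d≤K i = fold i next (suc m ∸ d) , (begin
    fold (fold i next (suc m ∸ d)) next d ≡⟨ ≡-sym (fold-+ i next d) ⟩
    fold i next (d + (suc m ∸ d))          ≡⟨ cong (fold i next) (m+[n∸m]≡n d≤K) ⟩
    fold i next (suc m)                    ≡⟨ fold-next-period i ⟩
    i                                      ∎)
    where open ≡-Reasoning

  ¬cycAdj-three : 4 < suc m → ∀ j → ¬ CycAdj (suc m) j (next (next (next j)))
  ¬cycAdj-three 4<K j adj = [ ¬forward , ¬backward ] (cycAdj⇒cycShift adj)
    where
    3<K : 3 < suc m
    3<K = <-trans (n<1+n 3) 4<K
    three : CycShift (suc m) 3 (toℕ j) (toℕ (next (next (next j))))
    three = cycShift-fold 3 (<⇒≤ 3<K) j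
    ¬forward : ¬ CycShift (suc m) 1 (toℕ j) (toℕ (next (next (next j))))
    ¬forward one with cycShift-unique (<-trans (s≤s (s≤s z≤n)) 3<K) 3<K one three
    ... | ()
    ¬backward : ¬ CycShift (suc m) 1 (toℕ (next (next (next j)))) (toℕ j)
    ¬backward one = cycShift-irrefl (s≤s z≤n) 4<K (cycShift-step (toℕ<n j) (<⇒≤ 4<K) three one)

module ProperColouring {n} (G : Graph n) (c : Fin n → Bool) (proper : ∀ u v → Adj G u v → c u ≢ c v) where

  same-colour⇒¬adj : ∀ {u v} → c u ≡ c v → ¬ Adj G u v
  same-colour⇒¬adj cu≡cv u~v = proper _ _ u~v cu≡cv

  adj-adj⇒same-colour : ∀ {u v w} → Adj G u v → Adj G v w → c u ≡ c w
  adj-adj⇒same-colour u~v v~w = trans (¬-not (proper _ _ u~v)) (≡-sym (¬-not (proper _ _ (sym G v~w))))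

  triangle-free : ∀ {u v w} → Adj G u v → Adj G v w → ¬ Adj G u w
  triangle-free u~v v~w = same-colour⇒¬adj (adj-adj⇒same-colour u~v v~w)

walk-enters : ∀ {n} {G : Graph n} {P : Fin n → Set} → Decidable P →
              ∀ {x y} → Walk G x y → ¬ P x → P y → ∃₂ λ u v → Adj G u v × ¬ P u × P v
walk-enters P? here ¬Px Py = ⊥-elim (¬Px Py)
walk-enters P? (step {v = x′} x~x′ walk) ¬Px Py with P? x′
... | yes Px′ = _ , x′ , x~x′ , ¬Px , Px′
... | no ¬Px′ = walk-enters P? walk ¬Px′ Py

module _ {k : ℕ} where

  edgeAdj? : (E : List (Fin k × Fin k)) → ∀ i j → Dec (EdgeAdj E i j)
  edgeAdj? E i j = any? (λ (a , b) → (a ≟ i ×-dec b ≟ j) ⊎-dec (a ≟ j ×-dec b ≟ i)) E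

  edgeAdj-sym : ∀ (E : List (Fin k × Fin k)) {i j} → EdgeAdj E i j → EdgeAdj E j i
  edgeAdj-sym E = Any.map λ { {_ , _} → swap }

  -- The non-adjacent pairs i < j in lexicographic order, the order in which
  -- non-adjacency facts are supplied to induced-copy.
  nonEdges : List (Fin k × Fin k) → List (Fin k × Fin k)
  nonEdges E = filter (λ (i , j) → i Fin.<? j ×-dec ¬? (edgeAdj? E i j))
                      (cartesianProduct (allFin k) (allFin k))

  -- An adjacency-reflecting map out of a twin-free graph cannot identify two vertices,
  -- so induced copies of the armchair and the tripod come with injectivity for free.
  TwinFree : (Fin k → Fin k → Set) → Set
  TwinFree H = ∀ i j → (∀ l → H i l ⇔ H j l) → i ≡ j

  twinFree? : ∀ {H} → (∀ i j → Dec (H i j)) → Dec (TwinFree H)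
  twinFree? H? = Fin.all? λ i → Fin.all? λ j → Fin.all? (λ l → H? i l ⇔? H? j l) →-dec (i ≟ j)
    where
    _⇔?_ : ∀ {A B : Set} → Dec A → Dec B → Dec (A ⇔ B)
    a? ⇔? b? = map′ (λ (to , from) → mk⇔ to from) (λ e → Equivalence.to e , Equivalence.from e)
                    ((a? →-dec b?) ×-dec (b? →-dec a?))

  module _ {n} (G : Graph n) (E : List (Fin k × Fin k)) (twinFree : TwinFree (EdgeAdj E))
           (g : Fin k → Fin n)
           (edges : All (λ (i , j) → Adj G (g i) (g j)) E)
           (non-edges : All (λ (i , j) → ¬ Adj G (g i) (g j)) (nonEdges E)) where

    private
      edge⇒adj : ∀ {E′ i j} → All (λ (i , j) → Adj G (g i) (g j)) E′ → EdgeAdj E′ i j → Adj G (g i) (g j)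
      edge⇒adj (i~j ∷ _) (here (inj₁ (refl , refl))) = i~j
      edge⇒adj (j~i ∷ _) (here (inj₂ (refl , refl))) = sym G j~i
      edge⇒adj (_ ∷ adjs) (there e) = edge⇒adj adjs e

      nonEdge⇒¬adj : ∀ {i j} → ¬ EdgeAdj E i j → ¬ Adj G (g i) (g j)
      nonEdge⇒¬adj {i} {j} ¬e with Fin.<-cmp i j
      ... | tri< i<j _ _ = lookup non-edges
                             (∈-filter⁺ _ (∈-cartesianProduct⁺ (∈-allFin i) (∈-allFin j)) (i<j , ¬e))
      ... | tri≈ _ refl _ = irrefl G
      ... | tri> _ _ j<i = λ i~j → lookup non-edges
                             (∈-filter⁺ _ (∈-cartesianProduct⁺ (∈-allFin j) (∈-allFin i)) (j<i , ¬e ∘ edgeAdj-sym E))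
                             (sym G i~j)

      edge⇔adj : ∀ i j → EdgeAdj E i j ⇔ Adj G (g i) (g j)
      edge⇔adj i j = mk⇔ (edge⇒adj edges) λ i~j → decidable-stable (edgeAdj? E i j) (λ ¬e → nonEdge⇒¬adj ¬e i~j)

    induced-copy : HasInduced G k (EdgeAdj E)
    induced-copy = g , injective , edge⇔adj
      where
      injective : ∀ {i j} → g i ≡ g j → i ≡ j
      injective {i} {j} gi≡gj = twinFree i j λ l →
        ⇔.trans (edge⇔adj i l) (subst (λ x → Adj G x (g l) ⇔ EdgeAdj E j l) (≡-sym gi≡gj) (⇔.sym (edge⇔adj j l)))

armchair-twinFree : TwinFree (EdgeAdj armchair)
armchair-twinFree = toWitness {a? = twinFree? (edgeAdj? armchair)} _

tripod-twinFree : TwinFree (EdgeAdj tripod)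
tripod-twinFree = toWitness {a? = twinFree? (edgeAdj? tripod)} _

module Hole {n} (G : Graph n) (c : Fin n → Bool) (proper : ∀ u v → Adj G u v → c u ≢ c v)
            {m} (f : Fin (suc m) → Fin n) (f-iff : ∀ i j → CycAdj (suc m) i j ⇔ Adj G (f i) (f j))
            (4<K : 4 < suc m) where

  open ProperColouring G c proper

  at : Fin (suc m) → ℕ → Fin n
  at j d = f (fold j next d)

  at-adj : ∀ j d → Adj G (at j d) (at j (suc d))
  at-adj j d = Equivalence.to (f-iff _ _) (cycAdj-next (fold j next d))

  at-¬adj-three : ∀ j d → ¬ Adj G (at j d) (at j (3 + d))
  at-¬adj-three j d = ¬cycAdj-three 4<K (fold j next d) ∘ Equivalence.from (f-iff _ _)

  at-¬adj-four : ∀ j → ¬ Adj G (at j 0) (at j 4)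
  at-¬adj-four j = same-colour⇒¬adj (trans (adj-adj⇒same-colour (at-adj j 0) (at-adj j 1))
                                           (adj-adj⇒same-colour (at-adj j 2) (at-adj j 3)))

  module _ {u v} (u~v : Adj G u v) (u-far : ∀ i → ¬ Adj G u (f i)) where

    private
      ¬at-u : ∀ j d → ¬ Adj G (at j d) u
      ¬at-u j d = u-far _ ∘ sym G

      ¬sym : ∀ {a b} → ¬ Adj G a b → ¬ Adj G b a
      ¬sym ¬a~b = ¬a~b ∘ sym G

    armchair-around : ∀ j → Adj G v (at j 1) → Adj G v (at j 3) → HasInduced G 7 (EdgeAdj armchair)
    armchair-around j v~r₁ v~r₃ =
      induced-copy G armchair armchair-twinFree (vlookup (r 3 ∷ v ∷ r 1 ∷ r 2 ∷ r 4 ∷ u ∷ r 0 ∷ []))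
        (sym G v~r₃ ∷ v~r₁ ∷ r~r 1 ∷ r~r 2 ∷ r~r 3 ∷ sym G u~v ∷ sym G (r~r 0) ∷ [])
        (triangle-free (sym G (r~r 2)) (sym G (r~r 1)) ∷ ¬at-u j 3 ∷ ¬sym (at-¬adj-three j 0) ∷
         triangle-free v~r₁ (r~r 1) ∷ triangle-free v~r₃ (r~r 3) ∷ triangle-free v~r₁ (sym G (r~r 0)) ∷
         at-¬adj-three j 1 ∷ ¬at-u j 1 ∷
         triangle-free (r~r 2) (r~r 3) ∷ ¬at-u j 2 ∷ triangle-free (sym G (r~r 1)) (sym G (r~r 0)) ∷
         ¬at-u j 4 ∷ ¬sym (at-¬adj-four j) ∷
         u-far _ ∷ [])
      where
      r : ℕ → Fin n
      r = at j
      r~r : ∀ d → Adj G (r d) (r (suc d))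
      r~r = at-adj j

    tripod-around : ∀ j → Adj G v (at j 2) → ¬ Adj G v (at j 0) → ¬ Adj G v (at j 4) →
                    HasInduced G 7 (EdgeAdj tripod)
    tripod-around j v~r₂ v≁r₀ v≁r₄ =
      induced-copy G tripod tripod-twinFree (vlookup (r 2 ∷ r 1 ∷ r 0 ∷ r 3 ∷ r 4 ∷ v ∷ u ∷ []))
        (sym G (r~r 1) ∷ sym G (r~r 0) ∷ r~r 2 ∷ r~r 3 ∷ sym G v~r₂ ∷ sym G u~v ∷ [])
        (triangle-free (sym G (r~r 1)) (sym G (r~r 0)) ∷ triangle-free (r~r 2) (r~r 3) ∷ ¬at-u j 2 ∷
         triangle-free (r~r 1) (r~r 2) ∷ at-¬adj-three j 1 ∷ triangle-free (r~r 1) (sym G v~r₂) ∷ ¬at-u j 1 ∷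
         at-¬adj-three j 0 ∷ at-¬adj-four j ∷ ¬sym v≁r₀ ∷ ¬at-u j 0 ∷
         triangle-free (sym G (r~r 2)) (sym G v~r₂) ∷ ¬at-u j 3 ∷
         ¬sym v≁r₄ ∷ ¬at-u j 4 ∷ [])
      where
      r : ℕ → Fin n
      r = at j
      r~r : ∀ d → Adj G (r d) (r (suc d))
      r~r = at-adj j

    armchair-or-tripod : ∀ {i} → Adj G v (f i) → HasInduced G 7 (EdgeAdj armchair) ⊎ HasInduced G 7 (EdgeAdj tripod)
    armchair-or-tripod {i} v~i = around (adj? G v (at j 1)) (adj? G v (at j 5))
      where
      j+3≡i : ∃ λ j → fold j next 3 ≡ i
      j+3≡i = fold-next-surjective 3 (<⇒≤ (<-trans (n<1+n 3) 4<K)) i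
      j : Fin (suc m)
      j = proj₁ j+3≡i
      v~r₃ : Adj G v (at j 3)
      v~r₃ = subst (Adj G v ∘ f) (≡-sym (proj₂ j+3≡i)) v~i
      around : Dec (Adj G v (at j 1)) → Dec (Adj G v (at j 5)) →
               HasInduced G 7 (EdgeAdj armchair) ⊎ HasInduced G 7 (EdgeAdj tripod)
      around (yes v~r₁) _          = inj₁ (armchair-around j v~r₁ v~r₃)
      around (no _)     (yes v~r₅) = inj₁ (armchair-around (next (next j)) v~r₃ v~r₅)
      around (no v≁r₁)  (no v≁r₅)  = inj₂ (tripod-around (next j) v~r₃ v≁r₁ v≁r₅)

lemma15 : ∀ {n} (G : Graph n) → Connected G → Bipartite G → Fast G →
    ∀ (w : Fin n) → ¬ HoleAvoidingN G w
lemma15 G connected (c , proper) (no-armchair , _ , no-tripod) w (suc m , 4<K , f , _ , w-far , f-iff) =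
  let u , v , u~v , u-far , (i , v~i) = walk-enters near? (connected w (f zero)) (λ (i , w~i) → w-far i w~i)
                                                    (next zero , at-adj zero 0)
  in [ no-armchair , no-tripod ] (armchair-or-tripod u~v (λ i u~i → u-far (i , u~i)) v~i)
  where
  open Hole G c proper f f-iff 4<K
  near? : Decidable (λ x → ∃ λ i → Adj G x (f i))
  near? = λ x → Fin.any? λ i → adj? G x (f i)
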